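{- Let $T:\mathcal V\text{ -cat}\to\mathcal V\text{ -cat}$ be a 2-functor. If the final $T$-coalgebra exists, then the underlying set of its carrier is a colimit of the functor $VU:\mathrm{Coalg}(T)\to\mathrm{Set}$.
   Context: $\mathcal V=(\mathcal V_o,\otimes,I,[-,-])$ is a commutative quantale: $\mathcal V_o$ a complete lattice, $\otimes$ commutative associative with unit $I$ preserving joins in each variable, $x\otimes y\le z$ iff $y\le[x,z]$. $\mathcal V\text{ -cat}$ is the 2-category of small $\mathcal V$-categories (hom-values $\mathcal A(a,b)\in\mathcal V_o$ with $I\le\mathcal A(a,a)$, $\mathcal A(b,c)\otimes\mathcal A(a,b)\le\mathcal A(a,c)$), $\mathcal V$-functors ($\mathcal A(a,a')\le\mathcal B(fa,fa')$) and the pointwise order. A $T$-coalgebra is a $\mathcal V$-functor $\xi:\mathcal X\to T\mathcal X$; a morphism from $\xi:\mathcal X\to T\mathcal X$ to $\xi':\mathcal X'\to T\mathcal X'$ is a $\mathcal V$-functor $f:\mathcal X\to\mathcal X'$ with $\xi'f=Tf\cdot\xi$. $\mathrm{Coalg}(T)$ is the category of $T$-coalgebras; $U:\mathrm{Coalg}(T)\to\mathcal V\text{ -cat}$ and $V:\mathcal V\text{ -cat}\to\mathrm{Set}$ (set of objects) are the forgetful functors. -}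

module Defs where

open import Level using (Level; suc; _⊔_)
open import Data.Product using (Σ; _×_; _,_; proj₁; proj₂)
open import Relation.Binary.PropositionalEquality using (_≡_)

record Quantale (ℓ : Level) : Set (suc ℓ) where
  field
    V       : Set ℓ
    _≤_     : V → V → Set ℓ
    ≤-refl  : ∀ {x} → x ≤ x
    ≤-trans : ∀ {x y z} → x ≤ y → y ≤ z → x ≤ z
    ≤-antisym : ∀ {x y} → x ≤ y → y ≤ x → x ≡ y
    ⋁       : {J : Set ℓ} → (J → V) → V
    ⋁-upper : ∀ {J : Set ℓ} (f : J → V) (j : J) → f j ≤ ⋁ f
    ⋁-least : ∀ {J : Set ℓ} (f : J → V) (x : V) → (∀ j → f j ≤ x) → ⋁ f ≤ x
    _⊗_     : V → V → V
    I       : V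
    [_,_]   : V → V → V
    ⊗-assoc : ∀ x y z → (x ⊗ y) ⊗ z ≡ x ⊗ (y ⊗ z)
    ⊗-comm  : ∀ x y → x ⊗ y ≡ y ⊗ x
    ⊗-unitˡ : ∀ x → I ⊗ x ≡ x
    ⊗-⋁     : ∀ (x : V) {J : Set ℓ} (f : J → V) → x ⊗ ⋁ f ≡ ⋁ (λ j → x ⊗ f j)
    adjˡ    : ∀ {x y z} → (x ⊗ y) ≤ z → y ≤ [ x , z ]
    adjʳ    : ∀ {x y z} → y ≤ [ x , z ] → (x ⊗ y) ≤ z

module _ {ℓ : Level} (Q : Quantale ℓ) where
  open Quantale Q

  record VCat : Set (suc ℓ) where
    field
      Obj  : Set ℓ
      hom  : Obj → Obj → V
      hom-id   : ∀ a → I ≤ hom a a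
      hom-comp : ∀ a b c → (hom b c ⊗ hom a b) ≤ hom a c
  open VCat public

  record VFun (A B : VCat) : Set ℓ where
    field
      fun  : Obj A → Obj B
      fun-mono : ∀ a a' → hom A a a' ≤ hom B (fun a) (fun a')
  open VFun public

  idV : (A : VCat) → VFun A A
  idV A = record { fun = λ a → a ; fun-mono = λ a a' → ≤-refl }

  _∘V_ : {A B C : VCat} → VFun B C → VFun A B → VFun A C
  _∘V_ {A} g f = record { fun = λ a → fun g (fun f a)
                        ; fun-mono = λ a a' → ≤-trans (fun-mono f a a') (fun-mono g _ _) }

  _≈V_ : {A B : VCat} → VFun A B → VFun A B → Set ℓ
  _≈V_ {A} f g = ∀ (a : Obj A) → fun f a ≡ fun g a

  -- 2-cells of V-cat: the pointwise order f ≤ g iff I ≤ B(fa, ga) for all a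
  _≤V_ : {A B : VCat} → VFun A B → VFun A B → Set ℓ
  _≤V_ {A} {B} f g = ∀ (a : Obj A) → I ≤ hom B (fun f a) (fun g a)

  record TwoFunctor : Set (suc ℓ) where
    field
      F₀ : VCat → VCat
      F₁ : {A B : VCat} → VFun A B → VFun (F₀ A) (F₀ B)
      F-cong : {A B : VCat} {f g : VFun A B} → f ≈V g → F₁ f ≈V F₁ g
      F-id   : (A : VCat) → F₁ (idV A) ≈V idV (F₀ A)
      F-comp : {A B C : VCat} (g : VFun B C) (f : VFun A B) →
               F₁ (g ∘V f) ≈V (F₁ g ∘V F₁ f)
      F-mono : {A B : VCat} {f g : VFun A B} → f ≤V g → F₁ f ≤V F₁ g

  module _ (T : TwoFunctor) where
    open TwoFunctor T

    record Coalg : Set (suc ℓ) where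
      field
        carrier : VCat
        ξ       : VFun carrier (F₀ carrier)
    open Coalg public

    record CoalgHom (X Y : Coalg) : Set ℓ where
      field
        mor    : VFun (carrier X) (carrier Y)
        mor-eq : (ξ Y ∘V mor) ≈V (F₁ mor ∘V ξ X)
    open CoalgHom public

    IsFinal : Coalg → Set (suc ℓ)
    IsFinal Z = (X : Coalg) → Σ (CoalgHom X Z) λ h →
                  (k : CoalgHom X Z) → mor k ≈V mor h

    VU₀ : Coalg → Set ℓ
    VU₀ X = Obj (carrier X)

    VU₁ : {X Y : Coalg} → CoalgHom X Y → VU₀ X → VU₀ Y
    VU₁ h = fun (mor h)

    Cocone : Set ℓ → Set (suc ℓ)
    Cocone S = Σ ((X : Coalg) → VU₀ X → S) λ c →
                 {X Y : Coalg} (h : CoalgHom X Y) (x : VU₀ X) → c Y (VU₁ h x) ≡ c X x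

    IsColimit : (L : Set ℓ) → Cocone L → Set (suc ℓ)
    IsColimit L λc = (S : Set ℓ) (c : Cocone S) →
      Σ (L → S) λ u →
        ((X : Coalg) (x : VU₀ X) → u (proj₁ λc X x) ≡ proj₁ c X x)
        × ((u' : L → S) → ((X : Coalg) (x : VU₀ X) → u' (proj₁ λc X x) ≡ proj₁ c X x)
           → (l : L) → u' l ≡ u l)

-- A final coalgebra Z is a terminal object of Coalg(T), and any functor out of a
-- category with a terminal object has its value there as colimit: the legs are
-- the images of the unique morphisms X → Z, and a cocone c factors uniquely
-- through its own leg c_Z, because the unique morphism Z → Z is the identity.
module Submission where

open import Level using (Level)
open import Data.Product using (Σ; _,_; proj₁; proj₂)
open import Relation.Binary.PropositionalEquality using (_≡_; sym; trans; cong)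
open import Defs

module CoalgebraCategory {ℓ : Level} (Q : Quantale ℓ) (T : TwoFunctor Q) where
  open TwoFunctor T

  idH : (X : Coalg Q T) → CoalgHom Q T X X
  idH X = record
    { mor    = idV Q (carrier X)
    ; mor-eq = λ x → sym (F-id (carrier X) (fun (ξ X) x))
    }

  _∘H_ : {X Y Z : Coalg Q T} → CoalgHom Q T Y Z → CoalgHom Q T X Y → CoalgHom Q T X Z
  _∘H_ {X} g f = record
    { mor    = _∘V_ Q {carrier X} (mor g) (mor f)
    ; mor-eq = λ x → trans (mor-eq g (fun (mor f) x))
                     (trans (cong (fun (F₁ (mor g))) (mor-eq f x))
                            (sym (F-comp (mor g) (mor f) (fun (ξ X) x))))
    }

module FinalCoalgebra {ℓ : Level} (Q : Quantale ℓ) (T : TwoFunctor Q)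
                      (Z : Coalg Q T) (final : IsFinal Q T Z) where
  open CoalgebraCategory Q T

  ! : (X : Coalg Q T) → CoalgHom Q T X Z
  ! X = proj₁ (final X)

  !-unique : {X : Coalg Q T} (k : CoalgHom Q T X Z) (x : VU₀ Q T X) →
             VU₁ Q T k x ≡ VU₁ Q T (! X) x
  !-unique {X} = proj₂ (final X)

  !-natural : {X Y : Coalg Q T} (h : CoalgHom Q T X Y) (x : VU₀ Q T X) →
              VU₁ Q T (! Y) (VU₁ Q T h x) ≡ VU₁ Q T (! X) x
  !-natural {Y = Y} h = !-unique (! Y ∘H h)

  !-self : (z : VU₀ Q T Z) → z ≡ VU₁ Q T (! Z) z
  !-self = !-unique (idH Z)

  finalCocone : Cocone Q T (VU₀ Q T Z)
  finalCocone = (λ X → VU₁ Q T (! X)) , !-natural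

  finalCocone-isColimit : IsColimit Q T (VU₀ Q T Z) finalCocone
  finalCocone-isColimit S (c , c-natural) =
      c Z
    , (λ X → c-natural (! X))
    , λ u u-factors z → trans (cong u (!-self z)) (u-factors Z z)

proposition7p5 : {ℓ : Level} (Q : Quantale ℓ) (T : TwoFunctor Q) (Z : Coalg Q T) →
    IsFinal Q T Z →
    Σ (Cocone Q T (VU₀ Q T Z)) (λ λc → IsColimit Q T (VU₀ Q T Z) λc)
proposition7p5 Q T Z final = finalCocone , finalCocone-isColimit
  where open FinalCoalgebra Q T Z final
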